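{- Let $(c,d_1,\dots,d_n,M)$ be one of the five data listed in the context, and for $q=(q_1,\dots,q_n)\in M$ put $\varphi(q)=(cq_1-d_1,\dots,cq_n-d_n)\in\mathbb Z^n$. Then for every $q\in M$ the orbit of $\varphi(q)$ under the hyperoctahedral group $H_n=C_2^n\rtimes S_n$ (acting on $\mathbb Z^n$ by permutations of coordinates and sign changes of coordinates) has exactly $2^n n!$ elements.
   Context: The five cases (affine types with underlying finite type $B_n$ or $C_n$; $q$ denotes the integer coordinate vector of an element of the lattice $M$, and $\varphi(q)$ is an integer solution of $x_1^2+\dots+x_n^2=aN+b$ where $N$ is the $\Lambda_0$-atomic length of $q$): Type $B_n^{(1)}$ ($n\ge3$): $M=\{q\in\mathbb Z^n:\sum q_i\text{ even}\}$, $c=2n$, $d_i=n-i+1$. Type $C_n^{(1)}$ ($n\ge2$): $M=\mathbb Z^n$, $c=4n$, $d_i=2(n-i)+1$. Type $A_{2n-1}^{(2)}$ ($n\ge3$): $M=\{q\in\mathbb Z^n:\sum q_i\text{ even}\}$, $c=4n-2$, $d_i=2(n-i)+1$. Type $D_{n+1}^{(2)}$ ($n\ge2$): $M=\mathbb Z^n$, $c=2(n+1)$, $d_i=n-i+1$. Type $A_{2n}^{(2)}$ ($n\ge2$): $M=\mathbb Z^n$, $c=4n+2$, $d_i=2(n-i)+1$. -}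

module Defs where

open import Data.Nat as ℕ using (ℕ; zero; suc; _∸_; _≤_)
open import Data.Integer as ℤ using (ℤ; +_; -_)
open import Data.Integer.Divisibility using (_∣_)
open import Data.Bool using (Bool; true; false)
open import Data.Fin using (Fin; toℕ)
open import Data.Vec using (Vec; lookup; tabulate; foldr)
open import Data.Fin.Permutation using (Permutation′; _⟨$⟩ʳ_)
open import Data.Product using (Σ; ∃; _×_)
open import Data.Unit using (⊤)
open import Function.Definitions using (Injective)
open import Relation.Binary.PropositionalEquality using (_≡_)

data AffType : Set where
  B⁽¹⁾ C⁽¹⁾ A-odd⁽²⁾ D⁽²⁾ A-even⁽²⁾ : AffType
-- B⁽¹⁾ = B_n^(1), C⁽¹⁾ = C_n^(1), A-odd⁽²⁾ = A_{2n-1}^(2),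
-- D⁽²⁾ = D_{n+1}^(2), A-even⁽²⁾ = A_{2n}^(2)

ValidRank : AffType → ℕ → Set
ValidRank B⁽¹⁾      n = 3 ≤ n
ValidRank C⁽¹⁾      n = 2 ≤ n
ValidRank A-odd⁽²⁾  n = 3 ≤ n
ValidRank D⁽²⁾      n = 2 ≤ n
ValidRank A-even⁽²⁾ n = 2 ≤ n

cConst : AffType → ℕ → ℕ
cConst B⁽¹⁾      n = 2 ℕ.* n
cConst C⁽¹⁾      n = 4 ℕ.* n
cConst A-odd⁽²⁾  n = 4 ℕ.* n ∸ 2
cConst D⁽²⁾      n = 2 ℕ.* (n ℕ.+ 1)
cConst A-even⁽²⁾ n = 4 ℕ.* n ℕ.+ 2

-- d_i for the 1-based index i = toℕ j + 1, j : Fin n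
dConst : AffType → (n : ℕ) → Fin n → ℕ
dConst B⁽¹⁾      n j = n ∸ suc (toℕ j) ℕ.+ 1
dConst C⁽¹⁾      n j = 2 ℕ.* (n ∸ suc (toℕ j)) ℕ.+ 1
dConst A-odd⁽²⁾  n j = 2 ℕ.* (n ∸ suc (toℕ j)) ℕ.+ 1
dConst D⁽²⁾      n j = n ∸ suc (toℕ j) ℕ.+ 1
dConst A-even⁽²⁾ n j = 2 ℕ.* (n ∸ suc (toℕ j)) ℕ.+ 1

sumℤ : ∀ {n} → Vec ℤ n → ℤ
sumℤ = foldr _ ℤ._+_ (+ 0)

InM : AffType → ∀ {n} → Vec ℤ n → Set
InM B⁽¹⁾      q = (+ 2) ∣ sumℤ q
InM C⁽¹⁾      q = ⊤
InM A-odd⁽²⁾  q = (+ 2) ∣ sumℤ q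
InM D⁽²⁾      q = ⊤
InM A-even⁽²⁾ q = ⊤

φ : (t : AffType) → ∀ {n} → Vec ℤ n → Vec ℤ n
φ t {n} q = tabulate λ j → (+ cConst t n) ℤ.* lookup q j ℤ.- (+ dConst t n j)

record Hyperoct (n : ℕ) : Set where
  constructor hyp
  field
    signs : Fin n → Bool      -- true = change the sign of that coordinate
    perm  : Permutation′ n

applySign : Bool → ℤ → ℤ
applySign true  x = - x
applySign false x = x

act : ∀ {n} → Hyperoct n → Vec ℤ n → Vec ℤ n
act (hyp s π) v = tabulate λ i → applySign (s i) (lookup v (π ⟨$⟩ʳ i))

InOrbit : ∀ {n} → Vec ℤ n → Vec ℤ n → Set
InOrbit v w = ∃ λ g → act g v ≡ w

OrbitHasSize : ∀ {n} → Vec ℤ n → ℕ → Set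
OrbitHasSize {n} v k =
  Σ (Fin k → Vec ℤ n) λ f →
    Injective _≡_ _≡_ f
    × (∀ i → InOrbit v (f i))
    × (∀ w → InOrbit v w → ∃ λ i → f i ≡ w)

-- The hyperoctahedral group acts freely on the vectors whose coordinates are nonzero and have
-- pairwise distinct absolute values, so the orbit of such a vector has |Hₙ| = 2ⁿ n! elements.
-- The coordinates xᵢ = c qᵢ − dᵢ of φ(q) are of this kind: xᵢ = 0, or xᵢ = ±xⱼ with i ≠ j, would
-- make c divide dᵢ or dᵢ ∓ dⱼ, which is impossible as the dᵢ are distinct numbers in [1, c/2].
module Submission where

open import Defs
open import Data.Bool using (Bool; true; false)
open import Data.Fin using (Fin; zero; suc; toℕ; opposite; punchIn)
open import Data.Fin.Permutation as Perm
  using (Permutation′; _⟨$⟩ʳ_; insert; remove; insert-punchIn; insert-remove; remove-insert)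
open import Data.Fin.Properties
  using (*↔×; 2↔Bool; punchIn-injective; toℕ<n; toℕ-injective; opposite-prop; opposite-involutive)
open import Data.Integer as ℤ using (ℤ; +_; -[1+_]; -_; ∣_∣; 0ℤ)
open import Data.Integer.Divisibility.Signed using (divides; ∣⇒∣ᵤ) renaming (_∣_ to _∣ℤ_)
open import Data.Integer.Properties
  using (∣-i∣≡∣i∣; +-identityʳ; +-injective; ∣i∣≡0⇒i≡0; i-j≡0⇒i≡j; m-n≡m⊖n; ∣m⊝n∣≤m⊔n)
import Data.Integer.Tactic.RingSolver as ℤ-Solver
open import Data.Nat as ℕ using (ℕ; zero; suc; _+_; _*_; _∸_; _^_; _!; _≤_; _<_; >-nonZero)
open import Data.Nat.Divisibility using (_∣_; ∣⇒≤)
open import Data.Nat.Properties as ℕ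
  using ( ≤-trans; ≤-<-trans; <-≤-trans; ≤-antisym; <⇒≱; <⇒≢; ⊔-lub; m≤m+n; m≤n+m; m<m+n
        ; m∸n≤m; m+n≤o⇒m≤o∸n; +-cancelˡ-≤; *-monoʳ-≤; +-cancelʳ-≡; *-cancelˡ-≡)
import Data.Nat.Tactic.RingSolver as ℕ-Solver
open import Data.Product using (∃; _×_; _,_; <_,_>; uncurry)
open import Data.Product.Function.NonDependent.Setoid using (_×-inverse_)
open import Data.Product.Relation.Binary.Pointwise.NonDependent using (_×ₛ_; Pointwise-≡↔≡)
open import Data.Sum using (_⊎_; inj₁; inj₂)
open import Data.Vec using (Vec; lookup; tabulate)
open import Data.Vec.Functional using (_∷_; head; tail)
open import Data.Vec.Functional.Relation.Binary.Equality.Setoid using (≋-setoid)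
open import Data.Vec.Properties using (lookup∘tabulate; tabulate-cong)
open import Function.Base using (id)
open import Function.Bundles using (Inverse; Injection)
open import Function.Consequences.Setoid using (strictlyInverseˡ⇒inverseˡ; strictlyInverseʳ⇒inverseʳ)
import Function.Construct.Composition as Composition
import Function.Construct.Identity as Identity
import Function.Construct.Symmetry as Symmetry
open import Function.Definitions using (Congruent; Injective; StrictlyInverseˡ; StrictlyInverseʳ)
open import Function.Properties.Inverse using (Inverse⇒Injection)
open import Level using (0ℓ)
open import Relation.Binary.Bundles using (Setoid)
import Relation.Binary.Construct.On as On
open import Relation.Binary.PropositionalEquality as ≡
  using (_≡_; _≢_; refl; sym; trans; cong; cong₂; subst)
open import Relation.Nullary using (¬_; contradiction)

open Setoid using (Carrier)

strictInverse : ∀ {S T : Setoid 0ℓ 0ℓ} (to : Carrier S → Carrier T) (from : Carrier T → Carrier S) →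
  Congruent (Setoid._≈_ S) (Setoid._≈_ T) to → Congruent (Setoid._≈_ T) (Setoid._≈_ S) from →
  StrictlyInverseˡ (Setoid._≈_ T) to from → StrictlyInverseʳ (Setoid._≈_ S) to from →
  Inverse S T
strictInverse {S} {T} to from to-cong from-cong invˡ invʳ = record
  { to        = to
  ; from      = from
  ; to-cong   = to-cong
  ; from-cong = from-cong
  ; inverse   = strictlyInverseˡ⇒inverseˡ S T to-cong invˡ , strictlyInverseʳ⇒inverseʳ S T from-cong invʳ
  }

Enumeration : Setoid 0ℓ 0ℓ → ℕ → Set
Enumeration S k = Inverse (≡.setoid (Fin k)) S

enumerate-singleton : ∀ {S : Setoid 0ℓ 0ℓ} (x : Carrier S) → (∀ y z → Setoid._≈_ S y z) →
  Enumeration S 1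
enumerate-singleton {S} x all-equal =
  strictInverse (λ _ → x) (λ _ → zero) (λ _ → Setoid.refl S) (λ _ → refl)
    (all-equal x) (λ { zero → refl })

enumerate-× : ∀ {S T m n} → Enumeration S m → Enumeration T n → Enumeration (S ×ₛ T) (m * n)
enumerate-× E F =
  Composition.inverse (Composition.inverse *↔× (Symmetry.inverse Pointwise-≡↔≡)) (E ×-inverse F)

Signs : ℕ → Setoid 0ℓ 0ℓ
Signs = ≋-setoid (≡.setoid Bool)

cons-inverse : ∀ {n} → Inverse (≡.setoid Bool ×ₛ Signs n) (Signs (suc n))
cons-inverse = strictInverse (uncurry _∷_) < head , tail >
  (λ { (b≡b′ , s≋s′) → λ { zero → b≡b′ ; (suc i) → s≋s′ i } })
  (λ s≋s′ → s≋s′ zero , λ i → s≋s′ (suc i))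
  (λ s → λ { zero → refl ; (suc i) → refl })
  (λ _ → refl , λ _ → refl)

signs-enumeration : ∀ n → Enumeration (Signs n) (2 ^ n)
signs-enumeration zero    = enumerate-singleton (λ ()) (λ _ _ ())
signs-enumeration (suc n) = Composition.inverse (enumerate-× 2↔Bool (signs-enumeration n)) cons-inverse

Perms : ℕ → Setoid 0ℓ 0ℓ
Perms n = On.setoid {B = Permutation′ n} (≋-setoid (≡.setoid (Fin n)) n) _⟨$⟩ʳ_

insert-cong : ∀ {n} j {σ σ′ : Permutation′ n} → σ Perm.≈ σ′ → insert zero j σ Perm.≈ insert zero j σ′
insert-cong j          σ≈σ′ zero    = refl
insert-cong j {σ} {σ′} σ≈σ′ (suc k) = begin
  insert zero j σ ⟨$⟩ʳ suc k   ≡⟨ insert-punchIn zero j σ k ⟩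
  punchIn j (σ ⟨$⟩ʳ k)         ≡⟨ cong (punchIn j) (σ≈σ′ k) ⟩
  punchIn j (σ′ ⟨$⟩ʳ k)        ≡⟨ insert-punchIn zero j σ′ k ⟨
  insert zero j σ′ ⟨$⟩ʳ suc k  ∎
  where open ≡.≡-Reasoning

remove-cong : ∀ {n} {π π′ : Permutation′ (suc n)} → π Perm.≈ π′ → remove zero π Perm.≈ remove zero π′
remove-cong {π = π} {π′} π≈π′ k = punchIn-injective (π ⟨$⟩ʳ zero) _ _ (begin
  punchIn (π ⟨$⟩ʳ zero) (remove zero π ⟨$⟩ʳ k)            ≡⟨ insert-punchIn zero (π ⟨$⟩ʳ zero) (remove zero π) k ⟨
  insert zero (π ⟨$⟩ʳ zero) (remove zero π) ⟨$⟩ʳ suc k    ≡⟨ insert-remove zero π (suc k) ⟩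
  π ⟨$⟩ʳ suc k                                            ≡⟨ π≈π′ (suc k) ⟩
  π′ ⟨$⟩ʳ suc k                                           ≡⟨ insert-remove zero π′ (suc k) ⟨
  insert zero (π′ ⟨$⟩ʳ zero) (remove zero π′) ⟨$⟩ʳ suc k  ≡⟨ insert-punchIn zero (π′ ⟨$⟩ʳ zero) (remove zero π′) k ⟩
  punchIn (π′ ⟨$⟩ʳ zero) (remove zero π′ ⟨$⟩ʳ k)          ≡⟨ cong (λ j → punchIn j _) (π≈π′ zero) ⟨
  punchIn (π ⟨$⟩ʳ zero) (remove zero π′ ⟨$⟩ʳ k)           ∎)
  where open ≡.≡-Reasoning

insert-inverse : ∀ {n} → Inverse (≡.setoid (Fin (suc n)) ×ₛ Perms n) (Perms (suc n))
insert-inverse = strictInverse (uncurry (insert zero)) < _⟨$⟩ʳ zero , remove zero >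
  (λ { {j , _} {.j , _} (refl , σ≈σ′) → insert-cong j σ≈σ′ })
  (λ {π} {π′} π≈π′ → π≈π′ zero , remove-cong {π = π} {π′} π≈π′)
  (insert-remove zero)
  (λ { (j , σ) → refl , remove-insert zero j σ })

perms-enumeration : ∀ n → Enumeration (Perms n) (n !)
perms-enumeration zero    = enumerate-singleton Perm.id (λ _ _ ())
perms-enumeration (suc n) =
  Composition.inverse (enumerate-× (Identity.inverse _) (perms-enumeration n)) insert-inverse

HyperoctSetoid : ℕ → Setoid 0ℓ 0ℓ
HyperoctSetoid n = On.setoid (Signs n ×ₛ Perms n) < Hyperoct.signs , Hyperoct.perm >

hyperoct-enumeration : ∀ n → Enumeration (HyperoctSetoid n) (2 ^ n * n !)
hyperoct-enumeration n =
  Composition.inverse (enumerate-× (signs-enumeration n) (perms-enumeration n))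
    (strictInverse {S = Signs n ×ₛ Perms n} {T = HyperoctSetoid n}
      (uncurry hyp) < Hyperoct.signs , Hyperoct.perm > id id
      (λ g → Setoid.refl (HyperoctSetoid n) {g}) (λ p → Setoid.refl (Signs n ×ₛ Perms n) {p}))

∣applySign∣ : ∀ b x → ∣ applySign b x ∣ ≡ ∣ x ∣
∣applySign∣ true  x = ∣-i∣≡∣i∣ x
∣applySign∣ false x = refl

i≡-i⇒i≡0 : ∀ {i} → i ≡ - i → i ≡ 0ℤ
i≡-i⇒i≡0 {+ 0} _ = refl

applySign-cancelʳ : ∀ {x} → x ≢ 0ℤ → ∀ b b′ → applySign b x ≡ applySign b′ x → b ≡ b′
applySign-cancelʳ x≢0 true  true  _  = refl
applySign-cancelʳ x≢0 false false _  = refl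
applySign-cancelʳ x≢0 true  false eq = contradiction (i≡-i⇒i≡0 (sym eq)) x≢0
applySign-cancelʳ x≢0 false true  eq = contradiction (i≡-i⇒i≡0 eq) x≢0

∣i∣≡∣j∣⇒i≡j⊎i≡-j : ∀ i j → ∣ i ∣ ≡ ∣ j ∣ → i ≡ j ⊎ i ≡ - j
∣i∣≡∣j∣⇒i≡j⊎i≡-j (+ m)    (+ .m)       refl = inj₁ refl
∣i∣≡∣j∣⇒i≡j⊎i≡-j (+ _)    -[1+ n ]     refl = inj₂ refl
∣i∣≡∣j∣⇒i≡j⊎i≡-j -[1+ m ] (+ .(suc m)) refl = inj₂ refl
∣i∣≡∣j∣⇒i≡j⊎i≡-j -[1+ m ] -[1+ .m ]    refl = inj₁ refl

Regular : ∀ {n} → Vec ℤ n → Set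
Regular v = (∀ i → lookup v i ≢ 0ℤ) × Injective _≡_ _≡_ (λ i → ∣ lookup v i ∣)

module _ {n : ℕ} where
  open Setoid (HyperoctSetoid n) using (_≈_)

  lookup-act : ∀ (g : Hyperoct n) v i →
    lookup (act g v) i ≡ applySign (Hyperoct.signs g i) (lookup v (Hyperoct.perm g ⟨$⟩ʳ i))
  lookup-act (hyp s π) v i = lookup∘tabulate _ i

  act-cong : ∀ v {g h} → g ≈ h → act g v ≡ act h v
  act-cong v {hyp s π} {hyp s′ π′} (s≋s′ , π≈π′) =
    tabulate-cong (λ i → cong₂ applySign (s≋s′ i) (cong (lookup v) (π≈π′ i)))

  FreeAt : Vec ℤ n → Set
  FreeAt v = ∀ g h → act g v ≡ act h v → g ≈ h

  regular⇒free : ∀ v → Regular v → FreeAt v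
  regular⇒free v (nonzero , ∣v∣-injective) (hyp s π) (hyp s′ π′) gv≡hv = signs≡ , perms≡
    where
    coordinate : ∀ i → applySign (s i) (lookup v (π ⟨$⟩ʳ i)) ≡ applySign (s′ i) (lookup v (π′ ⟨$⟩ʳ i))
    coordinate i = trans (sym (lookup-act (hyp s π) v i))
      (trans (cong (λ w → lookup w i) gv≡hv) (lookup-act (hyp s′ π′) v i))
    perms≡ : ∀ i → π ⟨$⟩ʳ i ≡ π′ ⟨$⟩ʳ i
    perms≡ i = ∣v∣-injective
      (trans (sym (∣applySign∣ (s i) _)) (trans (cong ∣_∣ (coordinate i)) (∣applySign∣ (s′ i) _)))
    signs≡ : ∀ i → s i ≡ s′ i
    signs≡ i = applySign-cancelʳ (nonzero (π ⟨$⟩ʳ i)) (s i) (s′ i)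
      (trans (coordinate i) (cong (λ j → applySign (s′ i) (lookup v j)) (sym (perms≡ i))))

  orbit-of-free-vector : ∀ {k} v → Enumeration (HyperoctSetoid n) k → FreeAt v → OrbitHasSize v k
  orbit-of-free-vector {k} v E free = enum , enum-injective , enum-in-orbit , orbit-enumerated
    where
    open Inverse E
    enum : Fin k → Vec ℤ n
    enum i = act (to i) v
    enum-injective : Injective _≡_ _≡_ enum
    enum-injective {i} {j} eq = Injection.injective (Inverse⇒Injection E) (free (to i) (to j) eq)
    enum-in-orbit : ∀ i → InOrbit v (enum i)
    enum-in-orbit i = to i , refl
    orbit-enumerated : ∀ w → InOrbit v w → ∃ λ i → enum i ≡ w
    orbit-enumerated _ (g , refl) = from g , act-cong v {to (from g)} {g} (strictlyInverseˡ g)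

∣∧<⇒≡0 : ∀ {c k} → c ∣ k → k < c → k ≡ 0
∣∧<⇒≡0 {k = zero}  _   _   = refl
∣∧<⇒≡0 {k = suc k} c∣k k<c = contradiction (∣⇒≤ c∣k) (<⇒≱ k<c)

2*m≤o≤m+n⇒m≤n : ∀ {m n o} → 2 * m ≤ o → o ≤ m + n → m ≤ n
2*m≤o≤m+n⇒m≤n {m} {n} {o} 2m≤o o≤m+n =
  +-cancelˡ-≤ m m n (≤-trans (subst (_≤ o) (cong (λ k → m + k) (ℕ.+-identityʳ m)) 2m≤o) o≤m+n)

module _ (c : ℕ) where

  private
    recover : ∀ (c p m : ℤ) → m ≡ p ℤ.* c ℤ.- (c ℤ.* p ℤ.- m)
    recover = ℤ-Solver.solve-∀

    difference-identity : ∀ (c p p′ y : ℤ) → (p ℤ.* c ℤ.- y) ℤ.- (p′ ℤ.* c ℤ.- y) ≡ (p ℤ.- p′) ℤ.* c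
    difference-identity = ℤ-Solver.solve-∀

    sum-identity : ∀ (c p p′ y : ℤ) → (p ℤ.* c ℤ.- - y) ℤ.+ (p′ ℤ.* c ℤ.- y) ≡ (p ℤ.+ p′) ℤ.* c
    sum-identity = ℤ-Solver.solve-∀

  open ≡.≡-Reasoning

  c*p-m≡0⇒c∣m : ∀ p m → + c ℤ.* p ℤ.- + m ≡ 0ℤ → + c ∣ℤ + m
  c*p-m≡0⇒c∣m p m x≡0 = divides p (begin
    + m                                ≡⟨ recover (+ c) p (+ m) ⟩
    p ℤ.* + c ℤ.- (+ c ℤ.* p ℤ.- + m)  ≡⟨ cong (λ y → p ℤ.* + c ℤ.- y) x≡0 ⟩
    p ℤ.* + c ℤ.+ 0ℤ                   ≡⟨ +-identityʳ _ ⟩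
    p ℤ.* + c                          ∎)

  c*p-m≡c*p′-m′⇒c∣m-m′ : ∀ p p′ m m′ → + c ℤ.* p ℤ.- + m ≡ + c ℤ.* p′ ℤ.- + m′ → + c ∣ℤ + m ℤ.- + m′
  c*p-m≡c*p′-m′⇒c∣m-m′ p p′ m m′ x≡x′ = divides (p ℤ.- p′) (begin
    + m ℤ.- + m′                                 ≡⟨ cong₂ ℤ._-_ (recover (+ c) p (+ m)) (recover (+ c) p′ (+ m′)) ⟩
    (p ℤ.* + c ℤ.- x) ℤ.- (p′ ℤ.* + c ℤ.- x′)    ≡⟨ cong (λ y → (p ℤ.* + c ℤ.- y) ℤ.- (p′ ℤ.* + c ℤ.- x′)) x≡x′ ⟩
    (p ℤ.* + c ℤ.- x′) ℤ.- (p′ ℤ.* + c ℤ.- x′)   ≡⟨ difference-identity (+ c) p p′ x′ ⟩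
    (p ℤ.- p′) ℤ.* + c                           ∎)
    where
    x x′ : ℤ
    x  = + c ℤ.* p  ℤ.- + m
    x′ = + c ℤ.* p′ ℤ.- + m′

  c*p-m≡-[c*p′-m′]⇒c∣m+m′ : ∀ p p′ m m′ → + c ℤ.* p ℤ.- + m ≡ - (+ c ℤ.* p′ ℤ.- + m′) → + c ∣ℤ + m ℤ.+ + m′
  c*p-m≡-[c*p′-m′]⇒c∣m+m′ p p′ m m′ x≡-x′ = divides (p ℤ.+ p′) (begin
    + m ℤ.+ + m′                                 ≡⟨ cong₂ ℤ._+_ (recover (+ c) p (+ m)) (recover (+ c) p′ (+ m′)) ⟩
    (p ℤ.* + c ℤ.- x) ℤ.+ (p′ ℤ.* + c ℤ.- x′)    ≡⟨ cong (λ y → (p ℤ.* + c ℤ.- y) ℤ.+ (p′ ℤ.* + c ℤ.- x′)) x≡-x′ ⟩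
    (p ℤ.* + c ℤ.- - x′) ℤ.+ (p′ ℤ.* + c ℤ.- x′) ≡⟨ sum-identity (+ c) p p′ x′ ⟩
    (p ℤ.+ p′) ℤ.* + c                           ∎)
    where
    x x′ : ℤ
    x  = + c ℤ.* p  ℤ.- + m
    x′ = + c ℤ.* p′ ℤ.- + m′

module _ (c : ℕ) {n} {d : Fin n → ℕ} (d-injective : Injective _≡_ _≡_ d)
         (d-positive : ∀ i → 0 < d i) (2*d≤c : ∀ i → 2 * d i ≤ c) where

  private
    d<c : ∀ i → d i < c
    d<c i = <-≤-trans (subst (d i <_) (cong (λ k → d i + k) (sym (ℕ.+-identityʳ (d i))))
                                      (m<m+n (d i) (d-positive i)))
                      (2*d≤c i)

  c∤d : ∀ i → ¬ + c ∣ℤ + d i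
  c∤d i c∣d = <⇒≢ (d-positive i) (sym (∣∧<⇒≡0 (∣⇒∣ᵤ c∣d) (d<c i)))

  c∣d-d⇒≡ : ∀ i j → + c ∣ℤ + d i ℤ.- + d j → i ≡ j
  c∣d-d⇒≡ i j c∣d-d = d-injective (+-injective (i-j≡0⇒i≡j _ _ (∣i∣≡0⇒i≡0 ∣d-d∣≡0)))
    where
    ∣d-d∣<c : ∣ + d i ℤ.- + d j ∣ < c
    ∣d-d∣<c = ≤-<-trans
      (subst (_≤ d i ℕ.⊔ d j) (cong ∣_∣ (sym (m-n≡m⊖n (d i) (d j)))) (∣m⊝n∣≤m⊔n (d i) (d j)))
      (⊔-lub (d<c i) (d<c j))
    ∣d-d∣≡0 : ∣ + d i ℤ.- + d j ∣ ≡ 0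
    ∣d-d∣≡0 = ∣∧<⇒≡0 (∣⇒∣ᵤ c∣d-d) ∣d-d∣<c

  c∣d+d⇒≡ : ∀ i j → + c ∣ℤ + d i ℤ.+ + d j → i ≡ j
  c∣d+d⇒≡ i j c∣d+d = d-injective (≤-antisym
    (2*m≤o≤m+n⇒m≤n (2*d≤c i) c≤d+d)
    (2*m≤o≤m+n⇒m≤n (2*d≤c j) (subst (c ≤_) (ℕ.+-comm (d i) (d j)) c≤d+d)))
    where
    c≤d+d : c ≤ d i + d j
    c≤d+d = ∣⇒≤ {{>-nonZero (<-≤-trans (d-positive i) (m≤m+n (d i) (d j)))}} (∣⇒∣ᵤ c∣d+d)

  shifted-regular : (q : Vec ℤ n) → Regular (tabulate λ i → + c ℤ.* lookup q i ℤ.- + d i)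
  shifted-regular q = nonzero , ∣x∣-injective
    where
    x : Fin n → ℤ
    x i = + c ℤ.* lookup q i ℤ.- + d i
    nonzero : ∀ i → lookup (tabulate x) i ≢ 0ℤ
    nonzero i xᵢ≡0 = c∤d i (c*p-m≡0⇒c∣m c (lookup q i) (d i) (trans (sym (lookup∘tabulate x i)) xᵢ≡0))
    ∣x∣-injective : Injective _≡_ _≡_ (λ i → ∣ lookup (tabulate x) i ∣)
    ∣x∣-injective {i} {j} ∣xᵢ∣≡∣xⱼ∣ rewrite lookup∘tabulate x i | lookup∘tabulate x j
      with ∣i∣≡∣j∣⇒i≡j⊎i≡-j (x i) (x j) ∣xᵢ∣≡∣xⱼ∣
    ... | inj₁ xᵢ≡xⱼ  = c∣d-d⇒≡ i j (c*p-m≡c*p′-m′⇒c∣m-m′ c (lookup q i) (lookup q j) (d i) (d j) xᵢ≡xⱼ)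
    ... | inj₂ xᵢ≡-xⱼ = c∣d+d⇒≡ i j (c*p-m≡-[c*p′-m′]⇒c∣m+m′ c (lookup q i) (lookup q j) (d i) (d j) xᵢ≡-xⱼ)

module _ {n : ℕ} where

  reflected : Fin n → ℕ
  reflected i = n ∸ suc (toℕ i)

  reflected<n : ∀ i → reflected i < n
  reflected<n i = subst (_< n) (opposite-prop i) (toℕ<n (opposite i))

  reflected-injective : Injective _≡_ _≡_ reflected
  reflected-injective {i} {j} eq = trans (sym (opposite-involutive i))
    (trans (cong opposite (toℕ-injective (trans (opposite-prop i) (trans eq (sym (opposite-prop j))))))
           (opposite-involutive j))

2*[m+1]≤2*n : ∀ {m n} → m < n → 2 * (m + 1) ≤ 2 * n
2*[m+1]≤2*n {m} {n} m<n = *-monoʳ-≤ 2 (subst (_≤ n) (ℕ.+-comm 1 m) m<n)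

2*[2*m+1]≤4*n∸2 : ∀ {m n} → m < n → 2 * (2 * m + 1) ≤ 4 * n ∸ 2
2*[2*m+1]≤4*n∸2 {m} {n} m<n =
  m+n≤o⇒m≤o∸n (2 * (2 * m + 1)) (subst (_≤ 4 * n) (identity m) (*-monoʳ-≤ 4 m<n))
  where
  identity : ∀ m → 4 * suc m ≡ 2 * (2 * m + 1) + 2
  identity = ℕ-Solver.solve-∀

dConst-positive : ∀ t {n} (i : Fin n) → 0 < dConst t n i
dConst-positive B⁽¹⁾      i = m≤n+m 1 _
dConst-positive C⁽¹⁾      i = m≤n+m 1 _
dConst-positive A-odd⁽²⁾  i = m≤n+m 1 _
dConst-positive D⁽²⁾      i = m≤n+m 1 _
dConst-positive A-even⁽²⁾ i = m≤n+m 1 _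

dConst-injective : ∀ t {n} → Injective _≡_ _≡_ (dConst t n)
dConst-injective B⁽¹⁾      eq = reflected-injective (+-cancelʳ-≡ _ _ _ eq)
dConst-injective C⁽¹⁾      eq = reflected-injective (*-cancelˡ-≡ _ _ 2 (+-cancelʳ-≡ _ _ _ eq))
dConst-injective A-odd⁽²⁾  eq = reflected-injective (*-cancelˡ-≡ _ _ 2 (+-cancelʳ-≡ _ _ _ eq))
dConst-injective D⁽²⁾      eq = reflected-injective (+-cancelʳ-≡ _ _ _ eq)
dConst-injective A-even⁽²⁾ eq = reflected-injective (*-cancelˡ-≡ _ _ 2 (+-cancelʳ-≡ _ _ _ eq))

2*dConst≤cConst : ∀ t {n} (i : Fin n) → 2 * dConst t n i ≤ cConst t n
2*dConst≤cConst B⁽¹⁾          i = 2*[m+1]≤2*n (reflected<n i)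
2*dConst≤cConst C⁽¹⁾      {n} i = ≤-trans (2*[2*m+1]≤4*n∸2 (reflected<n i)) (m∸n≤m (4 * n) 2)
2*dConst≤cConst A-odd⁽²⁾      i = 2*[2*m+1]≤4*n∸2 (reflected<n i)
2*dConst≤cConst D⁽²⁾      {n} i = ≤-trans (2*[m+1]≤2*n (reflected<n i)) (*-monoʳ-≤ 2 (m≤m+n n 1))
2*dConst≤cConst A-even⁽²⁾ {n} i =
  ≤-trans (2*[2*m+1]≤4*n∸2 (reflected<n i)) (≤-trans (m∸n≤m (4 * n) 2) (m≤m+n (4 * n) 2))

φ-regular : ∀ t {n} (q : Vec ℤ n) → Regular (φ t q)
φ-regular t {n} = shifted-regular (cConst t n) (dConst-injective t) (dConst-positive t) (2*dConst≤cConst t)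

proposition8p51 : (t : AffType) (n : ℕ) → ValidRank t n →
    (q : Vec ℤ n) → InM t q →
    OrbitHasSize (φ t q) (2 ^ n * n !)
proposition8p51 t n _ q _ =
  orbit-of-free-vector (φ t q) (hyperoct-enumeration n) (regular⇒free (φ t q) (φ-regular t q))
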